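{- Let $a$ be a positive odd integer, let $k,m$ be nonnegative integers and let $n$ be a positive integer. Then $$t(a,3a,8k+2,8m+6;n)=\frac 23N(a,3a,8k+2,8m+6;8n+8k+8m+4a+8)-2N(a,3a,8k+2,8m+6;2n+2k+2m+a+2).$$
   Context: For positive integers $a,b,c,d$ and a nonnegative integer $n$, $N(a,b,c,d;n)$ denotes the number of $(x,y,z,w)\in\mathbb Z^4$ with $n=ax^2+by^2+cz^2+dw^2$, and $t(a,b,c,d;n)$ denotes the number of $(x,y,z,w)\in\mathbb Z^4$ with $n=a\frac{x(x-1)}2+b\frac{y(y-1)}2+c\frac{z(z-1)}2+d\frac{w(w-1)}2$. -}

module Defs where

open import Data.Nat as ℕ using (ℕ; zero; suc)
open import Data.Integer as ℤ using (ℤ; +_; -_)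
open import Data.List using (List; []; _∷_; map; length; filter; upTo; concatMap; _++_)
open import Data.Product using (_×_; _,_)
open import Relation.Binary.PropositionalEquality using (_≡_)
open import Relation.Nullary using (Dec)

symRange : ℕ → List ℤ
symRange B = map (λ i → + i) (upTo (suc B)) ++ map (λ i → - (+ (suc i))) (upTo B)

box4 : ℕ → List (ℤ × ℤ × ℤ × ℤ)
box4 B = concatMap (λ x → concatMap (λ y → concatMap (λ z → map (λ w → (x , y , z , w))
           (symRange B)) (symRange B)) (symRange B)) (symRange B)

quadForm : ℕ → ℕ → ℕ → ℕ → ℤ × ℤ × ℤ × ℤ → ℤ
quadForm a b c d (x , y , z , w) =
  + a ℤ.* (x ℤ.* x) ℤ.+ + b ℤ.* (y ℤ.* y) ℤ.+ + c ℤ.* (z ℤ.* z) ℤ.+ + d ℤ.* (w ℤ.* w)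

-- x(x-1)/2, computed as x(x-1) divided exactly by 2 (x(x-1) is always even)
tri : ℤ → ℤ
tri x = (x ℤ.* (x ℤ.- + 1)) ℤ./ (+ 2)

triForm : ℕ → ℕ → ℕ → ℕ → ℤ × ℤ × ℤ × ℤ → ℤ
triForm a b c d (x , y , z , w) =
  + a ℤ.* tri x ℤ.+ + b ℤ.* tri y ℤ.+ + c ℤ.* tri z ℤ.+ + d ℤ.* tri w

-- N(a,b,c,d;n) = #{(x,y,z,w) ∈ ℤ^4 : n = ax^2+by^2+cz^2+dw^2}, for positive a,b,c,d.
-- Since a,b,c,d ≥ 1, every solution satisfies |x|,|y|,|z|,|w| ≤ n, so it suffices
-- to count in the box [-n, n]^4.
N : ℕ → ℕ → ℕ → ℕ → ℕ → ℕ
N a b c d n = length (filter (λ v → quadForm a b c d v ℤ.≟ + n) (box4 n))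

-- t(a,b,c,d;n) = #{(x,y,z,w) ∈ ℤ^4 : n = a x(x-1)/2 + b y(y-1)/2 + c z(z-1)/2 + d w(w-1)/2}.
-- Since a,b,c,d ≥ 1 and x(x-1)/2 ≥ |x| - 1 ≥ 0 , any solution has |x| ≤ n + 1,
-- so it suffices to count in the box [-(n+1), n+1]^4.
t : ℕ → ℕ → ℕ → ℕ → ℕ → ℕ
t a b c d n = length (filter (λ v → triForm a b c d v ℤ.≟ + n) (box4 (suc n)))

module Submission where

-- Write Q = ax² + 3ay² + (8k+2)z² + (8m+6)w² and count solutions of Q(v) = M.
--  * v ↦ 2v − 1 maps the vectors counted by t bijectively onto the solutions with all
--    coordinates odd, because 8·x(x−1)/2 + 1 = (2x − 1)².
--  * Reducing Q(v) = M modulo 8 (a finite check over a mod 8 and the residues of x, y, z, w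
--    mod 4) shows that on solutions x ≡ y and z ≡ w (mod 2), and that for x even
--    (x, y) ≡ (0, 2) or (2, 0) (mod 4).
--  * For either parity of z, solutions with x odd split by whether x ≡ y (mod 4); y ↦ −y
--    swaps the two parts, and (x, y) ↦ ((x + 3y)/2, (x − y)/2), which preserves x² + 3y²,
--    maps the part with x ≡ y bijectively onto the solutions with x even.
--  * Solutions with x and z even are entirely even and halve to the solutions of Q(u) = M/4.
-- With C and D the numbers of solutions with x even and z odd, resp. even, this gives
-- t = 2C, N(M) = 3C + 3D and N(M/4) = D, and 2C = (2/3)(3C + 3D) − 2D.

open import Defs

module Proof where

  open import Data.Nat as ℕ using (ℕ; zero; suc; _≤_; _<_; z≤n; s≤s)
  import Data.Nat.Properties as ℕP
  import Data.Nat.DivMod as ℕD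
  open import Data.Nat.Divisibility using (_∣_; divides; m%n≡0⇒n∣m)
  import Data.Nat.Tactic.RingSolver as NatSolver
  open import Data.Integer as ℤ using (ℤ; +_; -[1+_]; -_; ∣_∣; _+_; _*_; _-_; 0ℤ)
  import Data.Integer.Properties as ℤP
  open import Data.Integer.DivMod using (_%ℕ_; _/ℕ_; a≡a%ℕn+[a/ℕn]*n; n%ℕd<d; div-pos-is-/ℕ)
  open import Data.Integer.Tactic.RingSolver using (solve-∀)
  open import Data.Bool using (Bool; true; false; _∧_; not)
  import Data.Bool.Properties as BoolP
  open import Data.List using (List; []; _∷_; map; length; filter; upTo; concatMap)
  open import Data.List.Properties using (length-map; filter-≐)
  open import Data.List.Membership.Propositional using (_∈_; _─_; lose; find)
  open import Data.List.Membership.Propositional.Properties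
  open import Data.List.Relation.Unary.Any using (here; there)
  open import Data.List.Relation.Unary.All as All using (All; []; _∷_)
  import Data.List.Relation.Unary.All.Properties as AllP
  open import Data.List.Relation.Unary.AllPairs using ([]; _∷_)
  open import Data.List.Relation.Unary.Unique.Propositional using (Unique)
  import Data.List.Relation.Unary.Unique.Propositional.Properties as Unique
  open import Data.Product using (∃; _×_; _,_; proj₁; proj₂)
  open import Data.Sum using (_⊎_; inj₁; inj₂)
  open import Data.Empty using (⊥; ⊥-elim)
  open import Function using (_∘_)
  open import Function.Bundles using (Equivalence)
  open import Level using (0ℓ)
  open import Relation.Binary.PropositionalEquality
  open import Relation.Nullary using (¬_; yes; no)
  open import Relation.Nullary.Decidable using (Dec; _×-dec_; _⊎-dec_; _→-dec_; ¬?; toWitness)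
  open import Relation.Unary using (Pred; Decidable; _≐_)

  count : {A : Set} {P : Pred A 0ℓ} → Decidable P → List A → ℕ
  count P? xs = length (filter P? xs)

  module _ {A : Set} where

    ∈-─ : ∀ {x y : A} {xs} (p : x ∈ xs) → y ∈ xs → y ≢ x → y ∈ xs ─ p
    ∈-─ (here refl) (here y≡x) y≢x = ⊥-elim (y≢x y≡x)
    ∈-─ (here refl) (there q)  _   = q
    ∈-─ (there p)   (here y≡v) _   = here y≡v
    ∈-─ (there p)   (there q)  y≢x = there (∈-─ p q y≢x)

    length-─ : ∀ {x : A} {xs} (p : x ∈ xs) → length xs ≡ suc (length (xs ─ p))
    length-─ (here _)  = refl
    length-─ (there p) = cong suc (length-─ p)

    unique-⊆-length : ∀ {xs ys : List A} → Unique xs → (∀ {x} → x ∈ xs → x ∈ ys) → length xs ≤ length ys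
    unique-⊆-length {[]}     _          _   = z≤n
    unique-⊆-length {x ∷ xs} (x∉ ∷ uxs) sub =
      let p = sub (here refl) in
      subst (suc (length xs) ≤_) (sym (length-─ p))
        (s≤s (unique-⊆-length uxs λ q → ∈-─ p (sub (there q)) λ y≡x → All.lookup x∉ q (sym y≡x)))

  module _ {A B : Set} (f : A → B) (g : B → A) where

    unique-map : ∀ {xs} → Unique xs → (∀ {x} → x ∈ xs → g (f x) ≡ x) → Unique (map f xs)
    unique-map {[]}     _          _   = []
    unique-map {x ∷ xs} (x∉ ∷ uxs) gf = distinct x∉ (λ q → gf (there q)) ∷ unique-map uxs (λ q → gf (there q))
      where
      distinct : ∀ {ys} → All (x ≢_) ys → (∀ {y} → y ∈ ys → g (f y) ≡ y) → All (f x ≢_) (map f ys)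
      distinct {[]}     []         _    = []
      distinct {y ∷ ys} (x≢y ∷ ne) gf′ =
        (λ fx≡fy → x≢y (trans (sym (gf (here refl))) (trans (cong g fx≡fy) (gf′ (here refl)))))
        ∷ distinct ne (λ q → gf′ (there q))

  module _ {A B : Set} {P : Pred A 0ℓ} {Q : Pred B 0ℓ} (P? : Decidable P) (Q? : Decidable Q) where

    Injects : (f : A → B) (g : B → A) → List A → List B → Set
    Injects f g xs ys = ∀ x → x ∈ xs → P x → (f x ∈ ys) × Q (f x) × (g (f x) ≡ x)

    count-≤ : ∀ {xs ys} → Unique xs → (f : A → B) (g : B → A) → Injects f g xs ys → count P? xs ≤ count Q? ys
    count-≤ {xs} {ys} uxs f g inj =
      subst (_≤ count Q? ys) (length-map f (filter P? xs))
        (unique-⊆-length (unique-map f g (Unique.filter⁺ P? uxs) left-inverse) image⊆)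
      where
      left-inverse : ∀ {x} → x ∈ filter P? xs → g (f x) ≡ x
      left-inverse q = let (x∈ , px) = ∈-filter⁻ P? q in proj₂ (proj₂ (inj _ x∈ px))
      image⊆ : ∀ {y} → y ∈ map f (filter P? xs) → y ∈ filter Q? ys
      image⊆ q with ∈-map⁻ f q
      ... | x , q′ , refl = let (x∈ , px) = ∈-filter⁻ P? q′ ; (fx∈ , qfx , _) = inj x x∈ px in ∈-filter⁺ Q? fx∈ qfx

  count-bijection : ∀ {A B : Set} {P : Pred A 0ℓ} {Q : Pred B 0ℓ} (P? : Decidable P) (Q? : Decidable Q)
    {xs ys} → Unique xs → Unique ys → (f : A → B) (g : B → A) →
    Injects P? Q? f g xs ys → Injects Q? P? g f ys xs → count P? xs ≡ count Q? ys
  count-bijection P? Q? uxs uys f g f-inj g-inj =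
    ℕP.≤-antisym (count-≤ P? Q? uxs f g f-inj) (count-≤ Q? P? uys g f g-inj)

  count-cong : ∀ {A : Set} {P R : Pred A 0ℓ} (P? : Decidable P) (R? : Decidable R) → P ≐ R → ∀ xs → count P? xs ≡ count R? xs
  count-cong P? R? P≐R xs = cong length (filter-≐ P? R? P≐R xs)

  count-split : ∀ {A : Set} {P R : Pred A 0ℓ} (P? : Decidable P) (R? : Decidable R) xs →
    count P? xs ≡ count (λ x → P? x ×-dec R? x) xs ℕ.+ count (λ x → P? x ×-dec ¬? (R? x)) xs
  count-split P? R? [] = refl
  count-split P? R? (x ∷ xs) with P? x | R? x
  ... | yes _ | yes _ = cong suc (count-split P? R? xs)
  ... | yes _ | no  _ = trans (cong suc (count-split P? R? xs)) (sym (ℕP.+-suc _ _))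
  ... | no  _ | yes _ = count-split P? R? xs
  ... | no  _ | no  _ = count-split P? R? xs

  symRange-complete : ∀ B x → ∣ x ∣ ≤ B → x ∈ symRange B
  symRange-complete B (+ i)    i≤B = ∈-++⁺ˡ (∈-map⁺ +_ (∈-upTo⁺ (s≤s i≤B)))
  symRange-complete B -[1+ i ] i<B = ∈-++⁺ʳ (map +_ (upTo (suc B))) (∈-map⁺ (λ i → - (+ suc i)) (∈-upTo⁺ i<B))

  symRange-unique : ∀ B → Unique (symRange B)
  symRange-unique B =
    Unique.++⁺ (Unique.map⁺ (λ { refl → refl }) (Unique.upTo⁺ (suc B)))
               (Unique.map⁺ (λ { refl → refl }) (Unique.upTo⁺ B))
               λ (p , q) → sign-clash p q
    where
    sign-clash : ∀ {v} → v ∈ map +_ (upTo (suc B)) → v ∈ map (λ i → - (+ suc i)) (upTo B) → ⊥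
    sign-clash p q with ∈-map⁻ +_ p | ∈-map⁻ (λ i → - (+ suc i)) q
    ... | _ , _ , refl | _ , _ , ()

  concatMap-all : ∀ {A B : Set} {P : B → Set} (g : A → List B) {ys} → (∀ y → All P (g y)) → All P (concatMap g ys)
  concatMap-all g {ys} h = AllP.concat⁺ (AllP.map⁺ (All.universal h ys))

  concatMap-unique : ∀ {A B : Set} (tag : B → A) (f : A → List B) {xs} → Unique xs → (∀ x → Unique (f x)) →
    (∀ x → All (λ b → tag b ≡ x) (f x)) → Unique (concatMap f xs)
  concatMap-unique tag f {[]}     _          _  _    = []
  concatMap-unique tag f {x ∷ xs} (x∉ ∷ uxs) uf tag≡ =
    Unique.++⁺ (uf x) (concatMap-unique tag f uxs uf tag≡) disjoint
    where
    disjoint : ∀ {b} → b ∈ f x × b ∈ concatMap f xs → ⊥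
    disjoint (p , q) with find (∈-concatMap⁻ f {xs = xs} q)
    ... | y , y∈ , r = All.lookup x∉ y∈ (trans (sym (All.lookup (tag≡ x) p)) (All.lookup (tag≡ y) r))

  module Layers (B : ℕ) where
    line : List ℤ
    line = symRange B

    layer₃ : ℤ → ℤ → ℤ → List (ℤ × ℤ × ℤ × ℤ)
    layer₃ x y z = map (λ w → (x , y , z , w)) line

    layer₂ : ℤ → ℤ → List (ℤ × ℤ × ℤ × ℤ)
    layer₂ x y = concatMap (layer₃ x y) line

    layer₁ : ℤ → List (ℤ × ℤ × ℤ × ℤ)
    layer₁ x = concatMap (layer₂ x) line

  box4-unique : ∀ B → Unique (box4 B)
  box4-unique B =
    concatMap-unique proj₁ layer₁ line-unique (λ x →
      concatMap-unique (λ v → proj₁ (proj₂ v)) (layer₂ x) line-unique (λ y →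
        concatMap-unique (λ v → proj₁ (proj₂ (proj₂ v))) (layer₃ x y) line-unique (λ z →
          Unique.map⁺ (λ { refl → refl }) line-unique)
        λ z → tagged refl)
      λ y → concatMap-all (layer₃ x y) {line} λ z → tagged refl)
    λ x → concatMap-all (layer₂ x) {line} λ y → concatMap-all (layer₃ x y) {line} λ z → tagged refl
    where
    open Layers B
    line-unique = symRange-unique B
    tagged : ∀ {P : ℤ × ℤ × ℤ × ℤ → Set} {x y z} → (∀ {w} → P (x , y , z , w)) → All P (layer₃ x y z)
    tagged p = AllP.map⁺ (All.universal (λ _ → p) line)

  box4-complete : ∀ B x y z w → ∣ x ∣ ≤ B → ∣ y ∣ ≤ B → ∣ z ∣ ≤ B → ∣ w ∣ ≤ B → (x , y , z , w) ∈ box4 B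
  box4-complete B x y z w x≤ y≤ z≤ w≤ =
    ∈-concatMap⁺ layer₁ (lose (range x x≤) (∈-concatMap⁺ (layer₂ x) (lose (range y y≤)
      (∈-concatMap⁺ (layer₃ x y) (lose (range z z≤) (∈-map⁺ (λ w → (x , y , z , w)) (range w w≤)))))))
    where
    open Layers B
    range = symRange-complete B

  diagonal-bounds : ∀ {a b c d p q r s S} → 0 < a → 0 < b → 0 < c → 0 < d →
    a ℕ.* p ℕ.+ b ℕ.* q ℕ.+ c ℕ.* r ℕ.+ d ℕ.* s ≡ S → p ≤ S × q ≤ S × r ≤ S × s ≤ S
  diagonal-bounds {a} {b} {c} {d} {p} {q} {r} {s} 0<a 0<b 0<c 0<d refl =
    ℕP.≤-trans (scaled p 0<a) (ℕP.≤-trans (ℕP.m≤m+n (a ℕ.* p) _) first-two) ,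
    ℕP.≤-trans (scaled q 0<b) (ℕP.≤-trans (ℕP.m≤n+m (b ℕ.* q) _) first-two) ,
    ℕP.≤-trans (scaled r 0<c) (ℕP.≤-trans (ℕP.m≤n+m (c ℕ.* r) _) first-three) ,
    ℕP.≤-trans (scaled s 0<d) (ℕP.m≤n+m (d ℕ.* s) _)
    where
    scaled : ∀ {k} m → 0 < k → m ≤ k ℕ.* m
    scaled {k@(suc _)} m _ = ℕP.m≤n*m m k
    first-three = ℕP.m≤m+n (a ℕ.* p ℕ.+ b ℕ.* q ℕ.+ c ℕ.* r) (d ℕ.* s)
    first-two = ℕP.≤-trans (ℕP.m≤m+n (a ℕ.* p ℕ.+ b ℕ.* q) (c ℕ.* r)) first-three

  diagonal : (ℤ → ℤ) → ℕ → ℕ → ℕ → ℕ → ℤ × ℤ × ℤ × ℤ → ℤ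
  diagonal F a b c d (x , y , z , w) = + a * F x + + b * F y + + c * F z + + d * F w

  pos-diagonal : ∀ a b c d p q r s →
    + a * + p + + b * + q + + c * + r + + d * + s ≡ + (a ℕ.* p ℕ.+ b ℕ.* q ℕ.+ c ℕ.* r ℕ.+ d ℕ.* s)
  pos-diagonal a b c d p q r s =
    sym (trans (ℤP.pos-+ (a ℕ.* p ℕ.+ b ℕ.* q ℕ.+ c ℕ.* r) (d ℕ.* s)) (cong₂ _+_
          (trans (ℤP.pos-+ (a ℕ.* p ℕ.+ b ℕ.* q) (c ℕ.* r)) (cong₂ _+_
             (trans (ℤP.pos-+ (a ℕ.* p) (b ℕ.* q)) (cong₂ _+_ (ℤP.pos-* a p) (ℤP.pos-* b q)))
             (ℤP.pos-* c r)))
          (ℤP.pos-* d s)))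

  diagonal-solution-in-box : ∀ (F : ℤ → ℤ) (ν : ℤ → ℕ) k → (∀ x → F x ≡ + ν x) → (∀ x → ∣ x ∣ ≤ k ℕ.+ ν x) →
    ∀ {a b c d} → 0 < a → 0 < b → 0 < c → 0 < d → ∀ {S} x y z w →
    diagonal F a b c d (x , y , z , w) ≡ + S → (x , y , z , w) ∈ box4 (k ℕ.+ S)
  diagonal-solution-in-box F ν k F≡ν bound {a} {b} {c} {d} 0<a 0<b 0<c 0<d {S} x y z w sol =
    let natural = ℤP.+-injective (trans (sym (pos-diagonal a b c d (ν x) (ν y) (ν z) (ν w)))
                    (trans (cong₂ _+_ (cong₂ _+_ (cong₂ _+_ (cong (+ a *_) (sym (F≡ν x))) (cong (+ b *_) (sym (F≡ν y))))
                                                 (cong (+ c *_) (sym (F≡ν z)))) (cong (+ d *_) (sym (F≡ν w)))) sol))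
        (px , py , pz , pw) = diagonal-bounds 0<a 0<b 0<c 0<d natural
        in-range : ∀ u → ν u ≤ S → ∣ u ∣ ≤ k ℕ.+ S
        in-range u νu≤S = ℕP.≤-trans (bound u) (ℕP.+-monoʳ-≤ k νu≤S)
    in box4-complete (k ℕ.+ S) x y z w (in-range x px) (in-range y py) (in-range z pz) (in-range w pw)

  square-natural : ∀ x → x * x ≡ + (∣ x ∣ ℕ.* ∣ x ∣)
  square-natural (+ n)    = sym (ℤP.pos-* n n)
  square-natural -[1+ n ] = refl

  quadForm-solution-in-box : ∀ {a b c d} → 0 < a → 0 < b → 0 < c → 0 < d → ∀ {S} x y z w →
    quadForm a b c d (x , y , z , w) ≡ + S → (x , y , z , w) ∈ box4 S
  quadForm-solution-in-box = diagonal-solution-in-box (λ x → x * x) (λ x → ∣ x ∣ ℕ.* ∣ x ∣) 0 square-natural bound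
    where
    bound : ∀ x → ∣ x ∣ ≤ ∣ x ∣ ℕ.* ∣ x ∣
    bound x with ∣ x ∣
    ... | zero  = z≤n
    ... | suc m = ℕP.m≤m*n (suc m) (suc m)

  -- triangle j = 0 + 1 + ... + j, the value of x(x-1)/2 at x = j + 1 and at x = -j.
  triangle : ℕ → ℕ
  triangle zero    = zero
  triangle (suc j) = suc j ℕ.+ triangle j

  triangle-double : ∀ j → triangle j ℕ.* 2 ≡ j ℕ.* suc j
  triangle-double zero    = refl
  triangle-double (suc j) = begin
    (suc j ℕ.+ triangle j) ℕ.* 2     ≡⟨ ℕP.*-distribʳ-+ 2 (suc j) (triangle j) ⟩
    suc j ℕ.* 2 ℕ.+ triangle j ℕ.* 2 ≡⟨ cong (suc j ℕ.* 2 ℕ.+_) (triangle-double j) ⟩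
    suc j ℕ.* 2 ℕ.+ j ℕ.* suc j      ≡⟨ expand j ⟩
    suc j ℕ.* suc (suc j)            ∎
    where
    open ≡-Reasoning
    expand : ∀ j → suc j ℕ.* 2 ℕ.+ j ℕ.* suc j ≡ suc j ℕ.* suc (suc j)
    expand = NatSolver.solve-∀

  tri-from-product : ∀ x q → x * (x - + 1) ≡ + (q ℕ.* 2) → tri x ≡ + q
  tri-from-product x q x[x-1]≡2q = begin
    tri x                   ≡⟨ div-pos-is-/ℕ (x * (x - + 1)) 2 ⟩
    x * (x - + 1) /ℕ 2    ≡⟨ cong (_/ℕ 2) x[x-1]≡2q ⟩
    + (q ℕ.* 2 ℕ./ 2)       ≡⟨ cong +_ (ℕD.m*n/n≡m q 2) ⟩
    + q                     ∎
    where open ≡-Reasoning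

  tri-natural : ℤ → ℕ
  tri-natural (+ zero)  = zero
  tri-natural (+ suc j) = triangle j
  tri-natural -[1+ j ]  = triangle (suc j)

  product-natural : ∀ x → x * (x - + 1) ≡ + (tri-natural x ℕ.* 2)
  product-natural (+ zero)  = refl
  product-natural (+ suc j) =
    trans (sym (ℤP.pos-* (suc j) j)) (cong +_ (trans (ℕP.*-comm (suc j) j) (sym (triangle-double j))))
  product-natural -[1+ j ]  = cong +_ (trans (unfolded j) (sym (triangle-double (suc j))))
    where
    -- the normal form of -[1+ j ] * -[1+ suc j ]
    unfolded : ∀ j → suc (suc (j ℕ.+ 0 ℕ.+ j ℕ.* suc (suc (j ℕ.+ 0)))) ≡ suc j ℕ.* suc (suc j)
    unfolded = NatSolver.solve-∀

  tri≡tri-natural : ∀ x → tri x ≡ + tri-natural x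
  tri≡tri-natural x = tri-from-product x (tri-natural x) (product-natural x)

  -- 8 tri(x) + 1 = (2x − 1)², which turns triangular numbers into odd squares.
  tri-square : ∀ x → tri x * + 8 + + 1 ≡ (+ 2 * x - + 1) * (+ 2 * x - + 1)
  tri-square x = begin
    tri x * + 8 + + 1                     ≡⟨ cong (λ t → t * + 8 + + 1) (tri≡tri-natural x) ⟩
    + ν * + 8 + + 1                       ≡⟨ regroup (+ ν) ⟩
    (+ ν * + 2) * + 4 + + 1               ≡⟨ cong (λ t → t * + 4 + + 1) (sym (trans (product-natural x) (ℤP.pos-* ν 2))) ⟩
    x * (x - + 1) * + 4 + + 1           ≡⟨ square x ⟩
    (+ 2 * x - + 1) * (+ 2 * x - + 1) ∎
    where
    open ≡-Reasoning
    ν = tri-natural x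
    regroup : ∀ t → t * + 8 + + 1 ≡ (t * + 2) * + 4 + + 1
    regroup = solve-∀
    square : ∀ x → x * (x - + 1) * + 4 + + 1 ≡ (+ 2 * x - + 1) * (+ 2 * x - + 1)
    square = solve-∀

  ∣x∣≤1+tri : ∀ x → ∣ x ∣ ≤ 1 ℕ.+ tri-natural x
  ∣x∣≤1+tri (+ zero)  = z≤n
  ∣x∣≤1+tri (+ suc j) = s≤s (j≤triangle j)
    where
    j≤triangle : ∀ j → j ≤ triangle j
    j≤triangle zero    = z≤n
    j≤triangle (suc j) = ℕP.m≤m+n (suc j) (triangle j)
  ∣x∣≤1+tri -[1+ j ]  = s≤s (ℕP.m≤n⇒m≤1+n (ℕP.m≤m+n j (triangle j)))

  triForm-solution-in-box : ∀ {a b c d} → 0 < a → 0 < b → 0 < c → 0 < d → ∀ {n} x y z w →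
    triForm a b c d (x , y , z , w) ≡ + n → (x , y , z , w) ∈ box4 (suc n)
  triForm-solution-in-box = diagonal-solution-in-box tri tri-natural 1 tri≡tri-natural ∣x∣≤1+tri

  module _ (d : ℕ) .{{_ : ℕ.NonZero d}} where

    private
      -- r + (1+j) d ≥ d, so it is not a remainder r′ < d.
      overshoot : ∀ j r r′ → r′ < d → + r + + suc j * + d ≢ + r′
      overshoot j r r′ r′<d eq =
        ℕP.<-irrefl refl (ℕP.<-≤-trans r′<d (subst (d ≤_) (ℤP.+-injective (trans (cong (λ t → + r + t) (ℤP.pos-* (suc j) d)) eq))
          (ℕP.≤-trans (ℕP.m≤m+n d (j ℕ.* d)) (ℕP.m≤n+m _ r))))

      same-remainder : ∀ t r r′ → r < d → r′ < d → + r + t * + d ≡ + r′ → r ≡ r′ × t ≡ 0ℤ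
      same-remainder (+ zero)  r r′ _   _    eq = ℤP.+-injective (trans (sym (drop-zero (+ r) (+ d))) eq) , refl
        where drop-zero : ∀ r d → r + 0ℤ * d ≡ r
              drop-zero = solve-∀
      same-remainder (+ suc j) r r′ _   r′<d eq = ⊥-elim (overshoot j r r′ r′<d eq)
      same-remainder -[1+ j ]  r r′ r<d _    eq = ⊥-elim (overshoot j r′ r r<d
        (trans (cong (λ u → u + + suc j * + d) (sym eq)) (cancel (+ r) (+ suc j) (+ d))))
        where cancel : ∀ r t d → (r + (- t) * d) + t * d ≡ r
              cancel = solve-∀

    divMod-unique : ∀ u r s → r < d → u ≡ + r + s * + d → u %ℕ d ≡ r × u /ℕ d ≡ s
    divMod-unique u r s r<d u≡ =
      let (r≡ , s-q≡0) = same-remainder (s - u /ℕ d) r (u %ℕ d) r<d (n%ℕd<d u d) difference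
      in sym r≡ , sym (ℤP.i-j≡0⇒i≡j s (u /ℕ d) s-q≡0)
      where
      open ≡-Reasoning
      difference : + r + (s - u /ℕ d) * + d ≡ + (u %ℕ d)
      difference = begin
        + r + (s - u /ℕ d) * + d               ≡⟨ regroup (+ r) s (u /ℕ d) (+ d) ⟩
        (+ r + s * + d) - u /ℕ d * + d         ≡⟨ cong (_- u /ℕ d * + d) (sym u≡) ⟩
        u - u /ℕ d * + d                       ≡⟨ cong (_- u /ℕ d * + d) (a≡a%ℕn+[a/ℕn]*n u d) ⟩
        (+ (u %ℕ d) + u /ℕ d * + d) - u /ℕ d * + d ≡⟨ cancel (+ (u %ℕ d)) (u /ℕ d * + d) ⟩
        + (u %ℕ d)                             ∎
        where
        regroup : ∀ r s q d → r + (s - q) * d ≡ (r + s * d) - q * d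
        regroup = solve-∀
        cancel : ∀ a b → (a + b) - b ≡ a
        cancel = solve-∀

  exact-half : ∀ u e → u ≡ e * + 2 → u /ℕ 2 ≡ e
  exact-half u e u≡2e = proj₂ (divMod-unique 2 u 0 e (s≤s z≤n) (trans u≡2e (sym (ℤP.+-identityˡ (e * + 2)))))

  cancel-8 : ∀ i j K → i * + 8 + K ≡ j * + 8 + K → i ≡ j
  cancel-8 i j K eq = ℤP.*-cancelʳ-≡ i j (+ 8) (trans (undo i K) (trans (cong (_- K) eq) (sym (undo j K))))
    where undo : ∀ i K → i * + 8 ≡ (i * + 8 + K) - K
          undo = solve-∀

  ρ : ℤ → ℕ
  ρ u = u %ℕ 4

  σ : ℤ → ℤ
  σ u = u /ℕ 4

  ρ-decomposition : ∀ u → u ≡ + ρ u + σ u * + 4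
  ρ-decomposition u = a≡a%ℕn+[a/ℕn]*n u 4

  ρ<4 : ∀ u → ρ u < 4
  ρ<4 u = n%ℕd<d u 4

  ρ-of : ∀ u r s → r < 4 → u ≡ + r + s * + 4 → ρ u ≡ r
  ρ-of u r s r<4 u≡ = proj₁ (divMod-unique 4 u r s r<4 u≡)

  residue-form : ∀ u {r} → ρ u ≡ r → u ≡ + r + σ u * + 4
  residue-form u refl = ρ-decomposition u

  ρ-shift : ∀ u w → ρ (u + w * + 4) ≡ ρ u
  ρ-shift u w = ρ-of (u + w * + 4) (ρ u) (σ u + w) (ρ<4 u)
    (trans (cong (_+ w * + 4) (ρ-decomposition u)) (regroup (+ ρ u) (σ u) w))
    where
    regroup : ∀ r s w → (r + s * + 4) + w * + 4 ≡ r + (s + w) * + 4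
    regroup = solve-∀

  ρ-compatible : ∀ (f : ℤ → ℤ) → (∀ r s → ∃ λ w → f (r + s * + 4) ≡ f r + w * + 4) → ∀ u → ρ (f u) ≡ ρ (f (+ ρ u))
  ρ-compatible f compat u =
    let (w , f≡) = compat (+ ρ u) (σ u) in
    trans (cong (ρ ∘ f) (ρ-decomposition u)) (trans (cong ρ f≡) (ρ-shift (f (+ ρ u)) w))

  below4 : {P : ℕ → Set} → P 0 → P 1 → P 2 → P 3 → ∀ r → r < 4 → P r
  below4 p0 p1 p2 p3 0 _ = p0
  below4 p0 p1 p2 p3 1 _ = p1
  below4 p0 p1 p2 p3 2 _ = p2
  below4 p0 p1 p2 p3 3 _ = p3
  below4 p0 p1 p2 p3 (suc (suc (suc (suc _)))) (s≤s (s≤s (s≤s (s≤s ()))))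

  oddResidue : ℕ → Bool
  oddResidue 1 = true
  oddResidue 3 = true
  oddResidue _ = false

  isOdd : ℤ → Bool
  isOdd u = oddResidue (ρ u)

  negResidue : ℕ → ℕ
  negResidue zero = zero
  negResidue r    = 4 ℕ.∸ r

  ρ-neg : ∀ u → ρ (- u) ≡ negResidue (ρ u)
  ρ-neg u = trans (ρ-compatible -_ (λ r s → - s , negate r s) u)
    (below4 {λ r → ρ (- + r) ≡ negResidue r} refl refl refl refl (ρ u) (ρ<4 u))
    where negate : ∀ r s → - (r + s * + 4) ≡ - r + (- s) * + 4
          negate = solve-∀

  odd-residue-flip : ∀ {r s} → oddResidue r ≡ true → oddResidue s ≡ true → (r ℕ.≡ᵇ negResidue s) ≡ not (r ℕ.≡ᵇ s)
  odd-residue-flip {0} ()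
  odd-residue-flip {2} ()
  odd-residue-flip {suc (suc (suc (suc _)))} ()
  odd-residue-flip {1} {0} _ ()
  odd-residue-flip {1} {2} _ ()
  odd-residue-flip {1} {suc (suc (suc (suc _)))} _ ()
  odd-residue-flip {3} {0} _ ()
  odd-residue-flip {3} {2} _ ()
  odd-residue-flip {3} {suc (suc (suc (suc _)))} _ ()
  odd-residue-flip {1} {1} _ _ = refl
  odd-residue-flip {1} {3} _ _ = refl
  odd-residue-flip {3} {1} _ _ = refl
  odd-residue-flip {3} {3} _ _ = refl

  isOdd-double : ∀ u → isOdd (+ 2 * u) ≡ false
  isOdd-double u = trans (cong oddResidue (ρ-compatible (+ 2 *_) (λ r s → + 2 * s , double r s) u))
    (below4 {λ r → oddResidue (ρ (+ 2 * + r)) ≡ false} refl refl refl refl (ρ u) (ρ<4 u))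
    where double : ∀ r s → + 2 * (r + s * + 4) ≡ + 2 * r + (+ 2 * s) * + 4
          double = solve-∀

  isOdd-double+1 : ∀ u → isOdd (+ 2 * u + + 1) ≡ true
  isOdd-double+1 u = trans (cong oddResidue (ρ-compatible (λ x → + 2 * x + + 1) (λ r s → + 2 * s , double+1 r s) u))
    (below4 {λ r → oddResidue (ρ (+ 2 * + r + + 1)) ≡ true} refl refl refl refl (ρ u) (ρ<4 u))
    where double+1 : ∀ r s → + 2 * (r + s * + 4) + + 1 ≡ (+ 2 * r + + 1) + (+ 2 * s) * + 4
          double+1 = solve-∀

  bit : Bool → ℕ
  bit true  = 1
  bit false = 0

  parity-decomposition : ∀ u → u ≡ + bit (isOdd u) + (u /ℕ 2) * + 2
  parity-decomposition u = subst (λ b → u ≡ + b + (u /ℕ 2) * + 2) u%2≡bit (a≡a%ℕn+[a/ℕn]*n u 2)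
    where
    residue-parity : ∀ r → r < 4 → ∃ λ j → + r ≡ + bit (oddResidue r) + j * + 2
    residue-parity = below4 (+ 0 , refl) (+ 0 , refl) (+ 1 , refl) (+ 1 , refl)
    u%2≡bit : u %ℕ 2 ≡ bit (isOdd u)
    u%2≡bit =
      let (j , r≡) = residue-parity (ρ u) (ρ<4 u) in
      proj₁ (divMod-unique 2 u (bit (isOdd u)) (j + σ u * + 2) (bit<2 (isOdd u))
        (trans (ρ-decomposition u) (trans (cong (_+ σ u * + 4) r≡) (regroup (+ bit (isOdd u)) j (σ u)))))
      where
      bit<2 : ∀ b → bit b < 2
      bit<2 true  = s≤s (s≤s z≤n)
      bit<2 false = s≤s z≤n
      regroup : ∀ b j s → (b + j * + 2) + s * + 4 ≡ b + (j + s * + 2) * + 2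
      regroup = solve-∀

  even-half : ∀ u → isOdd u ≡ false → u ≡ + 2 * (u /ℕ 2)
  even-half u even = trans (parity-decomposition u) (subst (λ b → + bit b + (u /ℕ 2) * + 2 ≡ + 2 * (u /ℕ 2)) (sym even)
    (double (u /ℕ 2)))
    where double : ∀ h → + 0 + h * + 2 ≡ + 2 * h
          double = solve-∀

  odd-half : ∀ u → isOdd u ≡ true → + 2 * ((u + + 1) /ℕ 2) - + 1 ≡ u
  odd-half u odd =
    let u≡ = subst (λ b → u ≡ + bit b + (u /ℕ 2) * + 2) odd (parity-decomposition u)
        h = u /ℕ 2
    in trans (cong (λ e → + 2 * e - + 1) (exact-half (u + + 1) (h + + 1) (trans (cong (_+ + 1) u≡) (succ h))))
             (trans (back h) (sym u≡))
    where
    succ : ∀ h → (+ 1 + h * + 2) + + 1 ≡ (h + + 1) * + 2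
    succ = solve-∀
    back : ∀ h → + 2 * (h + + 1) - + 1 ≡ + 1 + h * + 2
    back = solve-∀

  -- R a₀ r = a₀(r_x² + 3r_y²) + 2r_z² + 6r_w² − 4a₀ : the value of Q(v) − M modulo 8,
  -- in terms of a₀ = a mod 8 and the residues r of x, y, z, w modulo 4.
  R : ℤ → ℤ → ℤ → ℤ → ℤ → ℤ
  R a₀ rx ry rz rw = a₀ * (rx * rx + + 3 * (ry * ry)) + + 2 * (rz * rz) + + 6 * (rw * rw) - + 4 * a₀

  EvenPair : ℕ → ℕ → Set
  EvenPair rx ry = (rx ≡ 0 × ry ≡ 2) ⊎ (rx ≡ 2 × ry ≡ 0)

  Admissible : ℕ → ℕ → ℕ → ℕ → Set
  Admissible rx ry rz rw =
    (oddResidue rx ≡ oddResidue ry) × (oddResidue rz ≡ oddResidue rw) × (oddResidue rx ≡ false → EvenPair rx ry)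

  admissible? : ∀ rx ry rz rw → Dec (Admissible rx ry rz rw)
  admissible? rx ry rz rw =
    (oddResidue rx BoolP.≟ oddResidue ry) ×-dec (oddResidue rz BoolP.≟ oddResidue rw) ×-dec
    ((oddResidue rx BoolP.≟ false) →-dec (((rx ℕP.≟ 0) ×-dec (ry ℕP.≟ 2)) ⊎-dec ((rx ℕP.≟ 2) ×-dec (ry ℕP.≟ 0))))

  -- The finite heart of the argument, checked by evaluation over all
  -- odd a₀ < 8 and all residues mod 4: R a₀ r ≡ 0 (mod 8) forces an admissible pattern.
  AdmissibleResidues : Set
  AdmissibleResidues = ∀ {a₀} → a₀ < 8 → a₀ ℕ.% 2 ≡ 1 →
    ∀ {rx} → rx < 4 → ∀ {ry} → ry < 4 → ∀ {rz} → rz < 4 → ∀ {rw} → rw < 4 →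
    R (+ a₀) (+ rx) (+ ry) (+ rz) (+ rw) %ℕ 8 ≡ 0 → Admissible rx ry rz rw

  admissible-residues : AdmissibleResidues
  admissible-residues = toWitness {a? = decide} _
    where
    open ℕP using (allUpTo?)
    decide : Dec AdmissibleResidues
    decide = allUpTo? (λ a₀ → (a₀ ℕ.% 2 ℕP.≟ 1) →-dec
               allUpTo? (λ rx → allUpTo? (λ ry → allUpTo? (λ rz → allUpTo? (λ rw →
                 (R (+ a₀) (+ rx) (+ ry) (+ rz) (+ rw) %ℕ 8 ℕP.≟ 0) →-dec admissible? rx ry rz rw) 4) 4) 4) 4) 8

  module Form (a k m : ℕ) where

    V4 : Set
    V4 = ℤ × ℤ × ℤ × ℤ

    Q : V4 → ℤ
    Q = quadForm a (3 ℕ.* a) (8 ℕ.* k ℕ.+ 2) (8 ℕ.* m ℕ.+ 6)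

    target : ℕ → ℕ
    target n = 8 ℕ.* n ℕ.+ 8 ℕ.* k ℕ.+ 8 ℕ.* m ℕ.+ 4 ℕ.* a ℕ.+ 8

    Q-integral : ∀ x y z w → Q (x , y , z , w) ≡
      + a * (x * x) + (+ 3 * + a) * (y * y) + (+ 8 * + k + + 2) * (z * z) + (+ 8 * + m + + 6) * (w * w)
    Q-integral x y z w = cong₂ (λ b cd → + a * (x * x) + b * (y * y) + proj₁ cd * (z * z) + proj₂ cd * (w * w))
      (ℤP.pos-* 3 a) (cong₂ _,_ (cast k 2) (cast m 6))
      where cast : ∀ i j → + (8 ℕ.* i ℕ.+ j) ≡ + 8 * + i + + j
            cast i j = trans (ℤP.pos-+ (8 ℕ.* i) j) (cong (_+ + j) (ℤP.pos-* 8 i))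

    target-integral : ∀ n → + target n ≡ + 8 * + n + + 8 * + k + + 8 * + m + + 4 * + a + + 8
    target-integral n =
      trans (ℤP.pos-+ (8 ℕ.* n ℕ.+ 8 ℕ.* k ℕ.+ 8 ℕ.* m ℕ.+ 4 ℕ.* a) 8) (cong (_+ + 8)
      (trans (ℤP.pos-+ (8 ℕ.* n ℕ.+ 8 ℕ.* k ℕ.+ 8 ℕ.* m) (4 ℕ.* a)) (cong₂ _+_
        (trans (ℤP.pos-+ (8 ℕ.* n ℕ.+ 8 ℕ.* k) (8 ℕ.* m)) (cong₂ _+_
          (trans (ℤP.pos-+ (8 ℕ.* n) (8 ℕ.* k)) (cong₂ _+_ (ℤP.pos-* 8 n) (ℤP.pos-* 8 k)))
          (ℤP.pos-* 8 m)))
        (ℤP.pos-* 4 a))))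

    a₀ : ℕ
    a₀ = a ℕ.% 8

    a-decomposition : + a ≡ + a₀ + + (a ℕ./ 8) * + 8
    a-decomposition = trans (cong +_ (ℕD.m≡m%n+[m/n]*n a 8))
      (trans (ℤP.pos-+ a₀ _) (cong (λ t → + a₀ + t) (ℤP.pos-* (a ℕ./ 8) 8)))

    Q-minus-target : ∀ n x y z w → ∃ λ U → Q (x , y , z , w) - + target n ≡ R (+ a₀) (+ ρ x) (+ ρ y) (+ ρ z) (+ ρ w) + U * + 8
    Q-minus-target n x y z w = quotient , (begin
      Q (x , y , z , w) - + target n  ≡⟨ cong₂ _-_ (Q-integral x y z w) (target-integral n) ⟩
      difference (+ a) (x , y , z , w) ≡⟨ cong₂ difference a-decomposition
                                            (cong₂ _,_ (ρ-decomposition x) (cong₂ _,_ (ρ-decomposition y)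
                                              (cong₂ _,_ (ρ-decomposition z) (ρ-decomposition w)))) ⟩
      difference (+ a₀ + + (a ℕ./ 8) * + 8) (+ ρ x + σ x * + 4 , + ρ y + σ y * + 4 , + ρ z + σ z * + 4 , + ρ w + σ w * + 4)
        ≡⟨ reduction-mod-8 (+ a₀) (+ (a ℕ./ 8)) (+ k) (+ m) (+ n) (+ ρ x) (+ ρ y) (+ ρ z) (+ ρ w) (σ x) (σ y) (σ z) (σ w) ⟩
      R (+ a₀) (+ ρ x) (+ ρ y) (+ ρ z) (+ ρ w) + quotient * + 8 ∎)
      where
      open ≡-Reasoning
      B = + (a ℕ./ 8)
      -- writing u = r + 4s, u² = r² + 8·excess r s
      excess : ℤ → ℤ → ℤ
      excess r s = r * s + + 2 * (s * s)
      square : ℤ → ℤ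
      square u = (+ ρ u + σ u * + 4) * (+ ρ u + σ u * + 4)
      quotient : ℤ
      quotient = + a₀ * (excess (+ ρ x) (σ x) + + 3 * excess (+ ρ y) (σ y)) + B * (square x + + 3 * square y)
                 + + k * square z + + 2 * excess (+ ρ z) (σ z) + + m * square w + + 6 * excess (+ ρ w) (σ w)
                 - (+ n + + k + + m + + 4 * B + + 1)
      difference : ℤ → V4 → ℤ
      difference A (X , Y , Z , W) = A * (X * X) + (+ 3 * A) * (Y * Y) + (+ 8 * + k + + 2) * (Z * Z) + (+ 8 * + m + + 6) * (W * W)
                                     - (+ 8 * + n + + 8 * + k + + 8 * + m + + 4 * A + + 8)
      reduction-mod-8 : ∀ a₀ B k m n rx ry rz rw sx sy sz sw →
        (a₀ + B * + 8) * ((rx + sx * + 4) * (rx + sx * + 4)) + (+ 3 * (a₀ + B * + 8)) * ((ry + sy * + 4) * (ry + sy * + 4))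
          + (+ 8 * k + + 2) * ((rz + sz * + 4) * (rz + sz * + 4)) + (+ 8 * m + + 6) * ((rw + sw * + 4) * (rw + sw * + 4))
          - (+ 8 * n + + 8 * k + + 8 * m + + 4 * (a₀ + B * + 8) + + 8)
        ≡ (a₀ * (rx * rx + + 3 * (ry * ry)) + + 2 * (rz * rz) + + 6 * (rw * rw) - + 4 * a₀)
          + (a₀ * (rx * sx + + 2 * (sx * sx) + + 3 * (ry * sy + + 2 * (sy * sy)))
             + B * ((rx + sx * + 4) * (rx + sx * + 4) + + 3 * ((ry + sy * + 4) * (ry + sy * + 4)))
             + k * ((rz + sz * + 4) * (rz + sz * + 4)) + + 2 * (rz * sz + + 2 * (sz * sz))
             + m * ((rw + sw * + 4) * (rw + sw * + 4)) + + 6 * (rw * sw + + 2 * (sw * sw))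
             - (n + k + m + + 4 * B + + 1)) * + 8
      reduction-mod-8 = solve-∀

    solution-admissible : ¬ (2 ∣ a) → ∀ n x y z w → Q (x , y , z , w) ≡ + target n → Admissible (ρ x) (ρ y) (ρ z) (ρ w)
    solution-admissible a-odd n x y z w sol =
      admissible-residues (ℕD.m%n<n a 8) a₀-odd (ρ<4 x) (ρ<4 y) (ρ<4 z) (ρ<4 w) R≡0-mod-8
      where
      a₀-odd : a₀ ℕ.% 2 ≡ 1
      a₀-odd = trans (ℕD.m∣n⇒o%n%m≡o%m 2 8 a (divides 4 refl)) (remainder (a ℕ.% 2) (ℕD.m%n<n a 2) refl)
        where
        remainder : ∀ r → r < 2 → a ℕ.% 2 ≡ r → r ≡ 1
        remainder 0 _ a%2≡0 = ⊥-elim (a-odd (m%n≡0⇒n∣m a 2 a%2≡0))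
        remainder 1 _ _     = refl
        remainder (suc (suc _)) (s≤s (s≤s ())) _
      R≡0-mod-8 : R (+ a₀) (+ ρ x) (+ ρ y) (+ ρ z) (+ ρ w) %ℕ 8 ≡ 0
      R≡0-mod-8 =
        let (U , Q-M≡) = Q-minus-target n x y z w
            r = R (+ a₀) (+ ρ x) (+ ρ y) (+ ρ z) (+ ρ w)
            r+8U≡0 : r + U * + 8 ≡ 0ℤ
            r+8U≡0 = trans (sym Q-M≡) (trans (cong (_- + target n) sol) (ℤP.+-inverseʳ (+ target n)))
        in proj₁ (divMod-unique 8 r 0 (- U) (s≤s z≤n)
             (trans (shift r U) (cong (λ t → t + (- U) * + 8) r+8U≡0)))
        where shift : ∀ r U → r ≡ (r + U * + 8) + (- U) * + 8
              shift = solve-∀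

  ∧-true : ∀ {x y} → x ∧ y ≡ true → x ≡ true × y ≡ true
  ∧-true {true} {true} _ = refl , refl

  true-∧ : ∀ {x y} → x ≡ true → y ≡ true → x ∧ y ≡ true
  true-∧ refl refl = refl

  ¬true⇔not : ∀ {x} → ¬ (x ≡ true) → not x ≡ true
  ¬true⇔not {false} _ = refl
  ¬true⇔not {true} x≢true = ⊥-elim (x≢true refl)

  not⇒¬true : ∀ {x} → not x ≡ true → ¬ (x ≡ true)
  not⇒¬true {false} _ ()

  not-true : ∀ {x} → not x ≡ true → x ≡ false
  not-true {false} _ = refl

  ≡⇒≡ᵇ-true : ∀ {r s} → r ≡ s → (r ℕ.≡ᵇ s) ≡ true
  ≡⇒≡ᵇ-true {r} refl = Equivalence.to BoolP.T-≡ (ℕP.≡⇒≡ᵇ r r refl)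

  ≡ᵇ-true⇒≡ : ∀ {r s} → (r ℕ.≡ᵇ s) ≡ true → r ≡ s
  ≡ᵇ-true⇒≡ {r} {s} p = ℕP.≡ᵇ⇒≡ r s (Equivalence.from BoolP.T-≡ p)

  module Solutions (a k m : ℕ) (0<a : 0 < a) where
    open Form a k m

    Test : Set
    Test = V4 → Bool

    infixr 7 _&_
    infix 8 ~_

    _&_ : Test → Test → Test
    (β & γ) v = β v ∧ γ v

    ~_ : Test → Test
    (~ β) v = not (β v)

    always : Test
    always _ = true

    Sol : ℕ → Test → V4 → Set
    Sol S β v = Q v ≡ + S × β v ≡ true

    sol? : ∀ S β → Decidable (Sol S β)
    sol? S β v = (Q v ℤ.≟ + S) ×-dec (β v BoolP.≟ true)

    #Sol : ℕ → Test → ℕ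
    #Sol S β = count (sol? S β) (box4 S)

    N≡#always : ∀ S → N a (3 ℕ.* a) (8 ℕ.* k ℕ.+ 2) (8 ℕ.* m ℕ.+ 6) S ≡ #Sol S always
    N≡#always S = count-cong (λ v → Q v ℤ.≟ + S) (sol? S always) ((λ sol → sol , refl) , proj₁) (box4 S)

    #-split : ∀ S β γ → #Sol S β ≡ #Sol S (β & γ) ℕ.+ #Sol S (β & ~ γ)
    #-split S β γ = trans (count-split (sol? S β) γ? (box4 S)) (cong₂ ℕ._+_
      (count-cong (λ v → sol? S β v ×-dec γ? v) (sol? S (β & γ)) (both , split) (box4 S))
      (count-cong (λ v → sol? S β v ×-dec ¬? (γ? v)) (sol? S (β & ~ γ)) (but-not , split-not) (box4 S)))
      where
      γ? = λ v → γ v BoolP.≟ true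
      both : ∀ {v} → Sol S β v × γ v ≡ true → Sol S (β & γ) v
      both ((sol , p) , q) = sol , true-∧ p q
      split : ∀ {v} → Sol S (β & γ) v → Sol S β v × γ v ≡ true
      split (sol , pq) = let (p , q) = ∧-true pq in (sol , p) , q
      but-not : ∀ {v} → Sol S β v × ¬ (γ v ≡ true) → Sol S (β & ~ γ) v
      but-not ((sol , p) , q) = sol , true-∧ p (¬true⇔not q)
      split-not : ∀ {v} → Sol S (β & ~ γ) v → Sol S β v × ¬ (γ v ≡ true)
      split-not (sol , pq) = let (p , q) = ∧-true pq in (sol , p) , not⇒¬true q

    #-cong : ∀ S β β′ → (∀ v → Q v ≡ + S → β v ≡ β′ v) → #Sol S β ≡ #Sol S β′
    #-cong S β β′ agree = count-cong (sol? S β) (sol? S β′)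
      ((λ (sol , p) → sol , trans (sym (agree _ sol)) p) , λ (sol , p) → sol , trans (agree _ sol) p) (box4 S)

    0<3a : 0 < 3 ℕ.* a
    0<3a = ℕP.*-monoʳ-< 3 0<a

    0<c : 0 < 8 ℕ.* k ℕ.+ 2
    0<c = ℕP.<-≤-trans (s≤s z≤n) (ℕP.m≤n+m 2 (8 ℕ.* k))

    0<d : 0 < 8 ℕ.* m ℕ.+ 6
    0<d = ℕP.<-≤-trans (s≤s z≤n) (ℕP.m≤n+m 6 (8 ℕ.* m))

    solution-in-box : ∀ S v → Q v ≡ + S → v ∈ box4 S
    solution-in-box S (x , y , z , w) = quadForm-solution-in-box 0<a 0<3a 0<c 0<d x y z w

    #-bijection : ∀ S S′ β β′ (f g : V4 → V4) →
      (∀ v → Sol S β v → Sol S′ β′ (f v) × g (f v) ≡ v) →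
      (∀ v → Sol S′ β′ v → Sol S β (g v) × f (g v) ≡ v) → #Sol S β ≡ #Sol S′ β′
    #-bijection S S′ β β′ f g f-ok g-ok =
      count-bijection (sol? S β) (sol? S′ β′) (box4-unique S) (box4-unique S′) f g
        (λ v _ sol → let (sol′ , gf) = f-ok v sol in solution-in-box S′ (f v) (proj₁ sol′) , sol′ , gf)
        (λ v _ sol → let (sol′ , fg) = g-ok v sol in solution-in-box S (g v) (proj₁ sol′) , sol′ , fg)

    -- The tests used below: parities of x and z, all coordinates odd, x ≡ y (mod 4),
    -- and tests looking only at z and w (which the maps below leave untouched).
    xOdd : Test
    xOdd (x , _ , _ , _) = isOdd x

    zOdd : Test
    zOdd (_ , _ , z , _) = isOdd z

    allOdd : Test
    allOdd (x , y , z , w) = isOdd x ∧ isOdd y ∧ isOdd z ∧ isOdd w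

    agree : Test
    agree (x , y , _ , _) = ρ x ℕ.≡ᵇ ρ y

    onZW : (ℤ → ℤ → Bool) → Test
    onZW θ (_ , _ , z , w) = θ z w

    flipY : V4 → V4
    flipY (x , y , z , w) = (x , - y , z , w)

    flipY-involutive : ∀ v → flipY (flipY v) ≡ v
    flipY-involutive (x , y , z , w) = cong (λ y′ → (x , y′ , z , w)) (ℤP.neg-involutive y)

    Q-flipY : ∀ v → Q (flipY v) ≡ Q v
    Q-flipY (x , y , z , w) = cong (λ s → + a * (x * x) + + (3 ℕ.* a) * s + + (8 ℕ.* k ℕ.+ 2) * (z * z) + + (8 ℕ.* m ℕ.+ 6) * (w * w))
      (square-neg y)
      where square-neg : ∀ y → (- y) * (- y) ≡ y * y
            square-neg = solve-∀

    -- The map (x, y) ↦ ((x + 3y)/2, (x − y)/2), which preserves x² + 3y² when x ≡ y (mod 2).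
    shear : V4 → V4
    shear (x , y , z , w) = ((x + + 3 * y) /ℕ 2 , (x - y) /ℕ 2 , z , w)

    shear-form : ∀ x y z w e → x + + 3 * y ≡ e * + 2 → shear (x , y , z , w) ≡ (e , e - + 2 * y , z , w)
    shear-form x y z w e x+3y≡2e = cong₂ (λ p q → (p , q , z , w)) (exact-half _ e x+3y≡2e)
      (exact-half _ (e - + 2 * y) (trans (difference x y) (trans (cong (_- + 4 * y) x+3y≡2e) (halve e y))))
      where
      difference : ∀ x y → x - y ≡ (x + + 3 * y) - + 4 * y
      difference = solve-∀
      halve : ∀ e y → e * + 2 - + 4 * y ≡ (e - + 2 * y) * + 2
      halve = solve-∀

    x-from-e : ∀ x y e → x + + 3 * y ≡ e * + 2 → x ≡ e * + 2 - + 3 * y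
    x-from-e x y e x+3y≡2e = trans (solve x y) (cong (_- + 3 * y) x+3y≡2e)
      where solve : ∀ x y → x ≡ (x + + 3 * y) - + 3 * y
            solve = solve-∀

    shear-involutive : ∀ x y z w e → x + + 3 * y ≡ e * + 2 → shear (shear (x , y , z , w)) ≡ (x , y , z , w)
    shear-involutive x y z w e x+3y≡2e =
      let x≡ = x-from-e x y e x+3y≡2e in
      trans (cong shear (shear-form x y z w e x+3y≡2e))
        (trans (shear-form e (e - + 2 * y) z w x (trans (sum e y) (cong (_* + 2) (sym x≡))))
          (cong (λ y′ → (x , y′ , z , w)) (trans (cong (_- + 2 * (e - + 2 * y)) x≡) (back e y))))
      where
      sum : ∀ e y → e + + 3 * (e - + 2 * y) ≡ (e * + 2 - + 3 * y) * + 2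
      sum = solve-∀
      back : ∀ e y → (e * + 2 - + 3 * y) - + 2 * (e - + 2 * y) ≡ y
      back = solve-∀

    Q-shear : ∀ x y z w e → x + + 3 * y ≡ e * + 2 → Q (shear (x , y , z , w)) ≡ Q (x , y , z , w)
    Q-shear x y z w e x+3y≡2e =
      trans (cong Q (shear-form x y z w e x+3y≡2e))
        (trans (cong (λ t → t + + (8 ℕ.* k ℕ.+ 2) * (z * z) + + (8 ℕ.* m ℕ.+ 6) * (w * w))
                     (subst (λ b → + a * (e * e) + b * ((e - + 2 * y) * (e - + 2 * y))
                                   ≡ + a * ((e * + 2 - + 3 * y) * (e * + 2 - + 3 * y)) + b * (y * y))
                            (sym (ℤP.pos-* 3 a)) (invariance (+ a) e y)))
               (cong (λ x′ → Q (x′ , y , z , w)) (sym (x-from-e x y e x+3y≡2e))))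
      where
      invariance : ∀ A e y → A * (e * e) + (+ 3 * A) * ((e - + 2 * y) * (e - + 2 * y))
                             ≡ A * ((e * + 2 - + 3 * y) * (e * + 2 - + 3 * y)) + (+ 3 * A) * (y * y)
      invariance = solve-∀

    double : V4 → V4
    double (x , y , z , w) = (+ 2 * x , + 2 * y , + 2 * z , + 2 * w)

    halve : V4 → V4
    halve (x , y , z , w) = (x /ℕ 2 , y /ℕ 2 , z /ℕ 2 , w /ℕ 2)

    halve-double : ∀ v → halve (double v) ≡ v
    halve-double (x , y , z , w) = cong₂ _,_ (half x) (cong₂ _,_ (half y) (cong₂ _,_ (half z) (half w)))
      where half : ∀ u → (+ 2 * u) /ℕ 2 ≡ u
            half u = exact-half (+ 2 * u) u (ℤP.*-comm (+ 2) u)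

    Q-double : ∀ v → Q (double v) ≡ + 4 * Q v
    Q-double (x , y , z , w) = scale (+ a) (+ (3 ℕ.* a)) (+ (8 ℕ.* k ℕ.+ 2)) (+ (8 ℕ.* m ℕ.+ 6)) x y z w
      where
      scale : ∀ A B C D x y z w →
        A * ((+ 2 * x) * (+ 2 * x)) + B * ((+ 2 * y) * (+ 2 * y)) + C * ((+ 2 * z) * (+ 2 * z)) + D * ((+ 2 * w) * (+ 2 * w))
        ≡ + 4 * (A * (x * x) + B * (y * y) + C * (z * z) + D * (w * w))
      scale = solve-∀

    lift : V4 → V4
    lift (x , y , z , w) = (+ 2 * x - + 1 , + 2 * y - + 1 , + 2 * z - + 1 , + 2 * w - + 1)

    unlift : V4 → V4
    unlift (x , y , z , w) = ((x + + 1) /ℕ 2 , (y + + 1) /ℕ 2 , (z + + 1) /ℕ 2 , (w + + 1) /ℕ 2)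

    unlift-lift : ∀ v → unlift (lift v) ≡ v
    unlift-lift (x , y , z , w) = cong₂ _,_ (back x) (cong₂ _,_ (back y) (cong₂ _,_ (back z) (back w)))
      where
      twice : ∀ u → (+ 2 * u - + 1) + + 1 ≡ u * + 2
      twice = solve-∀
      back : ∀ u → ((+ 2 * u - + 1) + + 1) /ℕ 2 ≡ u
      back u = exact-half _ u (twice u)

    allOdd-lift : ∀ v → allOdd (lift v) ≡ true
    allOdd-lift (x , y , z , w) = true-∧ (odd x) (true-∧ (odd y) (true-∧ (odd z) (odd w)))
      where
      shift : ∀ u → + 2 * u - + 1 ≡ + 2 * (u - + 1) + + 1
      shift = solve-∀
      odd : ∀ u → isOdd (+ 2 * u - + 1) ≡ true
      odd u = trans (cong isOdd (shift u)) (isOdd-double+1 (u - + 1))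

    coefficient-sum : ℤ
    coefficient-sum = + a + + (3 ℕ.* a) + + (8 ℕ.* k ℕ.+ 2) + + (8 ℕ.* m ℕ.+ 6)

    Q-lift : ∀ v → Q (lift v) ≡ triForm a (3 ℕ.* a) (8 ℕ.* k ℕ.+ 2) (8 ℕ.* m ℕ.+ 6) v * + 8 + coefficient-sum
    Q-lift (x , y , z , w)
      rewrite sym (tri-square x) | sym (tri-square y) | sym (tri-square z) | sym (tri-square w) =
      collect (+ a) (+ (3 ℕ.* a)) (+ (8 ℕ.* k ℕ.+ 2)) (+ (8 ℕ.* m ℕ.+ 6)) (tri x) (tri y) (tri z) (tri w)
      where
      collect : ∀ A B C D t₁ t₂ t₃ t₄ →
        A * (t₁ * + 8 + + 1) + B * (t₂ * + 8 + + 1) + C * (t₃ * + 8 + + 1) + D * (t₄ * + 8 + + 1)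
        ≡ (A * t₁ + B * t₂ + C * t₃ + D * t₄) * + 8 + (A + B + C + D)
      collect = solve-∀

    module AtTarget (a-odd : ¬ (2 ∣ a)) (n : ℕ) where

      M : ℕ
      M = target n

      admissible : ∀ x y z w → Q (x , y , z , w) ≡ + M → Admissible (ρ x) (ρ y) (ρ z) (ρ w)
      admissible = solution-admissible a-odd n

      module Doubling (θ : ℤ → ℤ → Bool) where

        β : Test
        β = xOdd & onZW θ

        β-flipY : ∀ v → Q v ≡ + M → (β & agree) (flipY v) ≡ (β & ~ agree) v
        β-flipY (x , y , z , w) sol with isOdd x in x-odd
        ... | false = refl
        ... | true  = cong (θ z w ∧_) (trans (cong (ρ x ℕ.≡ᵇ_) (ρ-neg y)) (odd-residue-flip x-odd y-odd))
          where y-odd = trans (sym (proj₁ (admissible x y z w sol))) x-odd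

        #-flipY : #Sol M (β & ~ agree) ≡ #Sol M (β & agree)
        #-flipY = #-bijection M M (β & ~ agree) (β & agree) flipY flipY
          (λ v (sol , p) → (trans (Q-flipY v) sol , trans (β-flipY v sol) p) , flipY-involutive v)
          (λ v (sol , p) → let sol′ = trans (Q-flipY v) sol in
            (sol′ , trans (sym (β-flipY (flipY v) sol′)) (subst (λ u → (β & agree) u ≡ true) (sym (flipY-involutive v)) p))
            , flipY-involutive v)

        -- x, y odd and x ≡ y (mod 4): x + 3y = 4w, so shear v has even first coordinate.
        shear-forward : ∀ v → Sol M (β & agree) v → Sol M (~ xOdd & onZW θ) (shear v) × shear (shear v) ≡ v
        shear-forward (x , y , z , w) (sol , p) =
          let (xθ , x≡y) = ∧-true {isOdd x ∧ θ z w} p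
              θzw = proj₂ (∧-true {isOdd x} xθ)
              ρy≡ρx = sym (≡ᵇ-true⇒≡ x≡y)
              e = + 2 * (+ ρ x + σ x + + 3 * σ y)
              x+3y≡2e : x + + 3 * y ≡ e * + 2
              x+3y≡2e = trans (cong₂ (λ x′ y′ → x′ + + 3 * y′) (ρ-decomposition x)
                                     (trans (ρ-decomposition y) (cong (λ r → + r + σ y * + 4) ρy≡ρx)))
                              (four-w (+ ρ x) (σ x) (σ y))
          in (trans (Q-shear x y z w e x+3y≡2e) sol
             , subst (λ u → (~ xOdd & onZW θ) u ≡ true) (sym (shear-form x y z w e x+3y≡2e))
                     (true-∧ (cong not (isOdd-double (+ ρ x + σ x + + 3 * σ y))) θzw))
             , shear-involutive x y z w e x+3y≡2e
          where
          four-w : ∀ r s t → (r + s * + 4) + + 3 * (r + t * + 4) ≡ (+ 2 * (r + s + + 3 * t)) * + 2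
          four-w = solve-∀

        shear-to-odd : ∀ x y z w u w′ → Q (x , y , z , w) ≡ + M → θ z w ≡ true →
          x + + 3 * y ≡ (+ 2 * u + + 1) * + 2 → + 2 * y ≡ w′ * + 4 →
          Sol M (β & agree) (shear (x , y , z , w)) × shear (shear (x , y , z , w)) ≡ (x , y , z , w)
        shear-to-odd x y z w u w′ sol θzw x+3y≡2e 2y≡4w′ =
          let e = + 2 * u + + 1
              same-residue : ρ e ≡ ρ (e - + 2 * y)
              same-residue = trans (cong ρ (trans (regroup e y) (cong (λ t → (e - + 2 * y) + t) 2y≡4w′)))
                                   (ρ-shift (e - + 2 * y) w′)
          in (trans (Q-shear x y z w e x+3y≡2e) sol
             , subst (λ v → (β & agree) v ≡ true) (sym (shear-form x y z w e x+3y≡2e))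
                     (true-∧ (true-∧ (isOdd-double+1 u) θzw) (≡⇒≡ᵇ-true same-residue)))
             , shear-involutive x y z w e x+3y≡2e
          where
          regroup : ∀ e y → e ≡ (e - + 2 * y) + + 2 * y
          regroup = solve-∀

        shear-even-pair : ∀ x y z w → Q (x , y , z , w) ≡ + M → θ z w ≡ true → EvenPair (ρ x) (ρ y) →
          Sol M (β & agree) (shear (x , y , z , w)) × shear (shear (x , y , z , w)) ≡ (x , y , z , w)
        shear-even-pair x y z w sol θzw (inj₁ (ρx≡0 , ρy≡2)) =
          shear-to-odd x y z w (σ x + + 3 * σ y + + 1) (+ 1 + + 2 * σ y) sol θzw
            (trans (cong₂ (λ x′ y′ → x′ + + 3 * y′) (residue-form x ρx≡0) (residue-form y ρy≡2)) (sum₀₂ (σ x) (σ y)))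
            (trans (cong (+ 2 *_) (residue-form y ρy≡2)) (double₂ (σ y)))
          where
          sum₀₂ : ∀ s t → (+ 0 + s * + 4) + + 3 * (+ 2 + t * + 4) ≡ (+ 2 * (s + + 3 * t + + 1) + + 1) * + 2
          sum₀₂ = solve-∀
          double₂ : ∀ t → + 2 * (+ 2 + t * + 4) ≡ (+ 1 + + 2 * t) * + 4
          double₂ = solve-∀
        shear-even-pair x y z w sol θzw (inj₂ (ρx≡2 , ρy≡0)) =
          shear-to-odd x y z w (σ x + + 3 * σ y) (+ 2 * σ y) sol θzw
            (trans (cong₂ (λ x′ y′ → x′ + + 3 * y′) (residue-form x ρx≡2) (residue-form y ρy≡0)) (sum₂₀ (σ x) (σ y)))
            (trans (cong (+ 2 *_) (residue-form y ρy≡0)) (double₀ (σ y)))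
          where
          sum₂₀ : ∀ s t → (+ 2 + s * + 4) + + 3 * (+ 0 + t * + 4) ≡ (+ 2 * (s + + 3 * t) + + 1) * + 2
          sum₂₀ = solve-∀
          double₀ : ∀ t → + 2 * (+ 0 + t * + 4) ≡ (+ 2 * t) * + 4
          double₀ = solve-∀

        shear-backward : ∀ v → Sol M (~ xOdd & onZW θ) v → Sol M (β & agree) (shear v) × shear (shear v) ≡ v
        shear-backward (x , y , z , w) (sol , p) =
          let (x-even , θzw) = ∧-true {not (isOdd x)} p in
          shear-even-pair x y z w sol θzw (proj₂ (proj₂ (admissible x y z w sol)) (not-true x-even))

        #-shear : #Sol M (β & agree) ≡ #Sol M (~ xOdd & onZW θ)
        #-shear = #-bijection M M (β & agree) (~ xOdd & onZW θ) shear shear shear-forward shear-backward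

        #-x-odd-double : #Sol M (xOdd & onZW θ) ≡ #Sol M (~ xOdd & onZW θ) ℕ.+ #Sol M (~ xOdd & onZW θ)
        #-x-odd-double = begin
          #Sol M β                                          ≡⟨ #-split M β agree ⟩
          #Sol M (β & agree) ℕ.+ #Sol M (β & ~ agree)       ≡⟨ cong (#Sol M (β & agree) ℕ.+_) #-flipY ⟩
          #Sol M (β & agree) ℕ.+ #Sol M (β & agree)         ≡⟨ cong₂ ℕ._+_ #-shear #-shear ⟩
          #Sol M (~ xOdd & onZW θ) ℕ.+ #Sol M (~ xOdd & onZW θ) ∎
          where open ≡-Reasoning

      quarter : ℕ
      quarter = 2 ℕ.* n ℕ.+ 2 ℕ.* k ℕ.+ 2 ℕ.* m ℕ.+ a ℕ.+ 2

      M≡4·quarter : + M ≡ + 4 * + quarter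
      M≡4·quarter = trans (cong +_ (expand n k m a)) (ℤP.pos-* 4 quarter)
        where expand : ∀ n k m a → 8 ℕ.* n ℕ.+ 8 ℕ.* k ℕ.+ 8 ℕ.* m ℕ.+ 4 ℕ.* a ℕ.+ 8
                                   ≡ 4 ℕ.* (2 ℕ.* n ℕ.+ 2 ℕ.* k ℕ.+ 2 ℕ.* m ℕ.+ a ℕ.+ 2)
              expand = NatSolver.solve-∀

      M≡8n+coefficient-sum : + M ≡ + n * + 8 + coefficient-sum
      M≡8n+coefficient-sum = trans (cong +_ (expand n k m a)) (trans (ℤP.pos-+ (n ℕ.* 8) _) (cong₂ _+_ (ℤP.pos-* n 8)
        (trans (ℤP.pos-+ (a ℕ.+ 3 ℕ.* a ℕ.+ c) d) (cong (_+ + d)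
          (trans (ℤP.pos-+ (a ℕ.+ 3 ℕ.* a) c) (cong (_+ + c) (ℤP.pos-+ a (3 ℕ.* a))))))))
        where
        c = 8 ℕ.* k ℕ.+ 2
        d = 8 ℕ.* m ℕ.+ 6
        expand : ∀ n k m a → 8 ℕ.* n ℕ.+ 8 ℕ.* k ℕ.+ 8 ℕ.* m ℕ.+ 4 ℕ.* a ℕ.+ 8
                             ≡ n ℕ.* 8 ℕ.+ (a ℕ.+ 3 ℕ.* a ℕ.+ (8 ℕ.* k ℕ.+ 2) ℕ.+ (8 ℕ.* m ℕ.+ 6))
        expand = NatSolver.solve-∀

      -- Solutions with x and z even have all coordinates even (by admissibility),
      -- and halving them gives the solutions of Q(u) = M/4.
      #-halving : #Sol M (~ xOdd & ~ zOdd) ≡ #Sol quarter always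
      #-halving = #-bijection M quarter (~ xOdd & ~ zOdd) always halve double to-quarter from-quarter
        where
        to-quarter : ∀ v → Sol M (~ xOdd & ~ zOdd) v → Sol quarter always (halve v) × double (halve v) ≡ v
        to-quarter v@(x , y , z , w) (sol , p) =
          let (x-even , z-even) = ∧-true {not (isOdd x)} p
              (xy , zw , _) = admissible x y z w sol
              even : ∀ u → isOdd u ≡ false → + 2 * (u /ℕ 2) ≡ u
              even u e = sym (even-half u e)
              doubled : double (halve v) ≡ v
              doubled = cong₂ _,_ (even x (not-true x-even)) (cong₂ _,_ (even y (trans (sym xy) (not-true x-even)))
                          (cong₂ _,_ (even z (not-true z-even)) (even w (trans (sym zw) (not-true z-even)))))
          in (ℤP.*-cancelˡ-≡ (+ 4) _ _ (trans (sym (Q-double (halve v))) (trans (cong Q doubled) (trans sol M≡4·quarter)))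
             , refl) , doubled
        from-quarter : ∀ u → Sol quarter always u → Sol M (~ xOdd & ~ zOdd) (double u) × halve (double u) ≡ u
        from-quarter u@(x , y , z , w) (sol , _) =
          (trans (Q-double u) (trans (cong (+ 4 *_) sol) (sym M≡4·quarter))
          , true-∧ (cong not (isOdd-double x)) (cong not (isOdd-double z))) , halve-double u

      -- On solutions x ≡ y and z ≡ w (mod 2), so "all coordinates odd" means "x and z odd".
      #-allOdd : #Sol M allOdd ≡ #Sol M (xOdd & zOdd)
      #-allOdd = #-cong M allOdd (xOdd & zOdd) same-test
        where
        collapse : ∀ b c → b ∧ b ∧ c ∧ c ≡ b ∧ c
        collapse false _     = refl
        collapse true  false = refl
        collapse true  true  = refl
        same-test : ∀ v → Q v ≡ + M → allOdd v ≡ (xOdd & zOdd) v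
        same-test (x , y , z , w) sol =
          let (xy , zw , _) = admissible x y z w sol in
          subst₂ (λ p q → isOdd x ∧ p ∧ isOdd z ∧ q ≡ isOdd x ∧ isOdd z) xy zw (collapse (isOdd x) (isOdd z))

      #-lift : t a (3 ℕ.* a) (8 ℕ.* k ℕ.+ 2) (8 ℕ.* m ℕ.+ 6) n ≡ #Sol M allOdd
      #-lift = count-bijection (λ v → triForm′ v ℤ.≟ + n) (sol? M allOdd) (box4-unique (suc n)) (box4-unique M)
                 lift unlift forward backward
        where
        triForm′ = triForm a (3 ℕ.* a) (8 ℕ.* k ℕ.+ 2) (8 ℕ.* m ℕ.+ 6)
        forward : Injects (λ v → triForm′ v ℤ.≟ + n) (sol? M allOdd) lift unlift (box4 (suc n)) (box4 M)
        forward v _ tri≡n =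
          let sol = trans (Q-lift v) (trans (cong (λ s → s * + 8 + coefficient-sum) tri≡n) (sym M≡8n+coefficient-sum)) in
          solution-in-box M (lift v) sol , (sol , allOdd-lift v) , unlift-lift v
        backward : Injects (sol? M allOdd) (λ v → triForm′ v ℤ.≟ + n) unlift lift (box4 M) (box4 (suc n))
        backward v@(x , y , z , w) _ (sol , odd) =
          let (ox , oyzw) = ∧-true {isOdd x} odd
              (oy , ozw) = ∧-true {isOdd y} oyzw
              (oz , ow) = ∧-true {isOdd z} ozw
              lifted : lift (unlift v) ≡ v
              lifted = cong₂ _,_ (odd-half x ox) (cong₂ _,_ (odd-half y oy) (cong₂ _,_ (odd-half z oz) (odd-half w ow)))
              tri≡n : triForm′ (unlift v) ≡ + n
              tri≡n = cancel-8 _ _ coefficient-sum (trans (sym (Q-lift (unlift v))) (trans (cong Q lifted) (trans sol M≡8n+coefficient-sum)))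
          in triForm-solution-in-box 0<a 0<3a 0<c 0<d _ _ _ _ tri≡n , tri≡n , lifted

      C D : ℕ
      C = #Sol M (~ xOdd & zOdd)
      D = #Sol M (~ xOdd & ~ zOdd)

      t≡2C : t a (3 ℕ.* a) (8 ℕ.* k ℕ.+ 2) (8 ℕ.* m ℕ.+ 6) n ≡ C ℕ.+ C
      t≡2C = trans #-lift (trans #-allOdd (Doubling.#-x-odd-double (λ z _ → isOdd z)))

      N[M]≡3C+3D : N a (3 ℕ.* a) (8 ℕ.* k ℕ.+ 2) (8 ℕ.* m ℕ.+ 6) M ≡ 3 ℕ.* C ℕ.+ 3 ℕ.* D
      N[M]≡3C+3D = begin
        N a (3 ℕ.* a) (8 ℕ.* k ℕ.+ 2) (8 ℕ.* m ℕ.+ 6) M      ≡⟨ N≡#always M ⟩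
        #Sol M always                                         ≡⟨ #-split M always xOdd ⟩
        #Sol M (always & xOdd) ℕ.+ #Sol M (always & ~ xOdd)
          ≡⟨ cong₂ ℕ._+_ (#-split M (always & xOdd) zOdd) (#-split M (always & ~ xOdd) zOdd) ⟩
        (#Sol M (xOdd & zOdd) ℕ.+ #Sol M (xOdd & ~ zOdd)) ℕ.+ (C ℕ.+ D)
          ≡⟨ cong (ℕ._+ (C ℕ.+ D)) (cong₂ ℕ._+_ (Doubling.#-x-odd-double (λ z _ → isOdd z))
                                                (Doubling.#-x-odd-double (λ z _ → not (isOdd z)))) ⟩
        ((C ℕ.+ C) ℕ.+ (D ℕ.+ D)) ℕ.+ (C ℕ.+ D)               ≡⟨ regroup C D ⟩
        3 ℕ.* C ℕ.+ 3 ℕ.* D                                   ∎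
        where
        open ≡-Reasoning
        regroup : ∀ C D → ((C ℕ.+ C) ℕ.+ (D ℕ.+ D)) ℕ.+ (C ℕ.+ D) ≡ 3 ℕ.* C ℕ.+ 3 ℕ.* D
        regroup = NatSolver.solve-∀

      N[M/4]≡D : N a (3 ℕ.* a) (8 ℕ.* k ℕ.+ 2) (8 ℕ.* m ℕ.+ 6) quarter ≡ D
      N[M/4]≡D = trans (N≡#always quarter) (sym #-halving)


module Rational where

  open import Data.Nat as ℕ using (ℕ)
  open import Data.Integer as ℤ using (+_)
  import Data.Integer.Properties as ℤP
  open import Data.Rational using (ℚ; mkℚ; _/_; _+_; _*_; _-_)
  import Data.Rational.Properties as ℚP
  open import Data.Rational.Solver using (module +-*-Solver)
  open import Data.Nat.Coprimality using (1-coprimeTo)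
  import Data.Nat.Coprimality as Coprimality
  open import Relation.Binary.PropositionalEquality

  ι : ℕ → ℚ
  ι x = + x / 1

  private
    ι≡mkℚ : ∀ x → ι x ≡ mkℚ (+ x) 0 (Coprimality.sym (1-coprimeTo x))
    ι≡mkℚ x = ℚP.normalize-coprime (Coprimality.sym (1-coprimeTo x))

  ι-+ : ∀ x y → ι (x ℕ.+ y) ≡ ι x + ι y
  ι-+ x y rewrite ι≡mkℚ x | ι≡mkℚ y =
    cong (_/ 1) (cong₂ ℤ._+_ (sym (ℤP.*-identityʳ (+ x))) (sym (ℤP.*-identityʳ (+ y))))

  ι-* : ∀ x y → ι (x ℕ.* y) ≡ ι x * ι y
  ι-* x y rewrite ι≡mkℚ x | ι≡mkℚ y = cong (_/ 1) (ℤP.pos-* x y)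

  rational-identity : ∀ C D → ι (C ℕ.+ C) ≡ (+ 2 / 3) * ι (3 ℕ.* C ℕ.+ 3 ℕ.* D) - (+ 2 / 1) * ι D
  rational-identity C D = begin
    ι (C ℕ.+ C)                                   ≡⟨ ι-+ C C ⟩
    ι C + ι C                                     ≡⟨ field-identity (ι C) (ι D) ⟩
    (+ 2 / 3) * (ι 3 * ι C + ι 3 * ι D) - (+ 2 / 1) * ι D
      ≡⟨ cong (λ s → (+ 2 / 3) * s - (+ 2 / 1) * ι D) (sym (trans (ι-+ (3 ℕ.* C) (3 ℕ.* D)) (cong₂ _+_ (ι-* 3 C) (ι-* 3 D)))) ⟩
    (+ 2 / 3) * ι (3 ℕ.* C ℕ.+ 3 ℕ.* D) - (+ 2 / 1) * ι D ∎
    where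
    open ≡-Reasoning
    open +-*-Solver
    field-identity : ∀ c d → c + c ≡ (+ 2 / 3) * (ι 3 * c + ι 3 * d) - (+ 2 / 1) * d
    field-identity = solve 2 (λ c d → c :+ c := con (+ 2 / 3) :* (con (ι 3) :* c :+ con (ι 3) :* d) :- con (+ 2 / 1) :* d) refl


open import Data.Nat using (ℕ; _+_; _*_; _>_)
open import Data.Nat.Divisibility using (_∣_)
open import Data.Integer using (+_)
open import Data.Rational using (_-_; _/_) renaming (_*_ to _*ℚ_)
open import Relation.Nullary using (¬_)
open import Relation.Binary.PropositionalEquality using (_≡_; cong; cong₂; sym; module ≡-Reasoning)
open Proof using (module Solutions)
open Rational using (ι; rational-identity)

theorem2p2 : (a k m n : ℕ) → a > 0 → ¬ (2 ∣ a) → n > 0 →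
    (+ t a (3 * a) (8 * k + 2) (8 * m + 6) n) / 1
    ≡ (+ 2 / 3) *ℚ ((+ N a (3 * a) (8 * k + 2) (8 * m + 6) (8 * n + 8 * k + 8 * m + 4 * a + 8)) / 1)
    - (+ 2 / 1) *ℚ ((+ N a (3 * a) (8 * k + 2) (8 * m + 6) (2 * n + 2 * k + 2 * m + a + 2)) / 1)
theorem2p2 a k m n a>0 a-odd _ = begin
  ι (t a (3 * a) (8 * k + 2) (8 * m + 6) n)  ≡⟨ cong ι t≡2C ⟩
  ι (C + C)                                  ≡⟨ rational-identity C D ⟩
  (+ 2 / 3) *ℚ ι (3 * C + 3 * D) - (+ 2 / 1) *ℚ ι D
    ≡⟨ cong₂ (λ p q → (+ 2 / 3) *ℚ ι p - (+ 2 / 1) *ℚ ι q) (sym N[M]≡3C+3D) (sym N[M/4]≡D) ⟩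
  (+ 2 / 3) *ℚ ι (N a (3 * a) (8 * k + 2) (8 * m + 6) M) - (+ 2 / 1) *ℚ ι (N a (3 * a) (8 * k + 2) (8 * m + 6) quarter) ∎
  where
  open Solutions a k m a>0
  open AtTarget a-odd n
  open ≡-Reasoning
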